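{- Fix an integer $r\geq 2$ and $\varepsilon>0$. There is a number $C(\varepsilon,r)$ such that for all sufficiently large $t$ and every integer $n>t^{C(\varepsilon,r)}$ there exist an $r$-uniform hypergraph $G$ and a $t$-thick partition $\mathcal P=\{V_1,\dots,V_n\}$ of $V(G)$ such that for each $i\in\{1,\dots,n\}$ at most $\left(\frac{(r-1)^{r-1}}{r^r}+\varepsilon\right)t^r$ edges of $G$ intersect $V_i$ (all edges of $G$ being stretched), but $\mathcal P$ has no independent transversal in $G$.
   Context: An $r$-uniform hypergraph has all edges of size $r$. A partition $\mathcal P$ of $V(G)$ into blocks is $t$-thick if every block has at least $t$ vertices. An edge is stretched (with respect to $\mathcal P$) if its vertices lie in pairwise distinct blocks. An independent transversal of $\mathcal P$ in $G$ is a set of vertices meeting each block in exactly one vertex and containing no edge of $G$. -}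

module Defs where

open import Data.Nat as ℕ using (ℕ; zero; suc; _^_)
open import Data.Nat.Properties using (m^n≢0)
open import Data.Fin using (Fin; _≟_)
open import Data.Fin.Properties using (any?)
open import Data.Fin.Subset using (Subset; _∈_; ∣_∣)
open import Data.Fin.Subset.Properties using (_∈?_)
open import Data.List using (List; length; filter; allFin)
open import Data.List.Membership.Propositional renaming (_∈_ to _∈ₗ_)
open import Data.List.Relation.Unary.All using (All)
open import Data.List.Relation.Unary.Unique.Propositional using (Unique)
open import Data.Product using (Σ; ∃; _×_; _,_)
open import Data.Integer using (+_)
open import Data.Rational using (ℚ; _/_)
open import Relation.Binary.PropositionalEquality using (_≡_)
open import Relation.Nullary using (¬_)
open import Relation.Nullary.Decidable using (_×-dec_)

record UniformHypergraph (r N : ℕ) : Set where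
  field
    edges   : List (Subset N)
    unique  : Unique edges
    uniform : All (λ e → ∣ e ∣ ≡ r) edges
open UniformHypergraph public

Partition : ℕ → ℕ → Set
Partition N n = Fin N → Fin n

blockSize : ∀ {N n} → Partition N n → Fin n → ℕ
blockSize {N} P i = length (filter (λ x → P x ≟ i) (allFin N))

Thick : ∀ {N n} → ℕ → Partition N n → Set
Thick t P = ∀ i → t ℕ.≤ blockSize P i

Stretched : ∀ {N n} → Partition N n → Subset N → Set
Stretched P e = ∀ x y → x ∈ e → y ∈ e → P x ≡ P y → x ≡ y

AllStretched : ∀ {r N n} → UniformHypergraph r N → Partition N n → Set
AllStretched G P = ∀ e → e ∈ₗ edges G → Stretched P e

edgesMeeting : ∀ {r N n} → UniformHypergraph r N → Partition N n → Fin n → ℕ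
edgesMeeting G P i =
  length (filter (λ e → any? (λ x → (x ∈? e) ×-dec (P x ≟ i))) (edges G))

record IndependentTransversal {r N n} (G : UniformHypergraph r N) (P : Partition N n) : Set where
  field
    choice      : Fin n → Fin N
    inBlock     : ∀ i → P (choice i) ≡ i
    independent : ∀ e → e ∈ₗ edges G → ¬ (∀ x → x ∈ e → ∃ λ i → x ≡ choice i)

-- the constant (r-1)^(r-1) / r^r as a rational (value for r = 0 irrelevant)
threshold : ℕ → ℚ
threshold zero = + 0 / 1
threshold (suc r) = (+ (r ^ r) / (suc r ^ suc r)) {{m^n≢0 (suc r) (suc r)}}

{-# OPTIONS --safe #-}
-- The blocks are arranged in a tree of depth m in which every edge joins a vertex
-- at a high position w ≥ j q of a block of level j to vertices at low positions
-- < (j + 1) q of p of its children.  By downward induction from the leaves, an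
-- independent transversal must pick in every block of level j a vertex of
-- position < j q, which is impossible at the root.  A block of level j lies in
-- (T - j q) ((j + 1) q) ^ p edges as the apex and in at most T ^ p as a child,
-- where T = m q ≈ t.  The first number is T ^ r x ^ p (1 - x + 1 / m) with
-- x = (j + 1) / m, hence at most p ^ p / r ^ r · T ^ r + T ^ p q by AM-GM, and
-- everything beyond the main term is O(t ^ r / m) ≤ ε t ^ r for m large.
module Submission where

open import Defs
open import Data.Nat using (ℕ)

module Arithmetic where

  open import Data.Nat using (zero; suc; _+_; _*_; _∸_; _^_; _≤_; _<_; NonZero; _/_; _%_)
  open import Data.Nat.Properties
  open import Data.Nat.DivMod using (+-distrib-/; m*n/n≡m; m*n%n≡0; m<n⇒m/n≡0; m<n⇒m%n≡m; [m+kn]%n≡m%n)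
  open import Data.Nat.Tactic.RingSolver using (solve-∀)
  open import Data.Product using (_×_; _,_)
  open import Data.Sum using (_⊎_; inj₁; inj₂)
  open import Relation.Binary.PropositionalEquality

  open ≤-Reasoning

  [k*d+x]/d≡k : ∀ k x d .{{_ : NonZero d}} → x < d → (k * d + x) / d ≡ k
  [k*d+x]/d≡k k x d x<d = begin-equality
    (k * d + x) / d        ≡⟨ +-distrib-/ (k * d) x (subst (_< d) (sym (cong₂ _+_ (m*n%n≡0 k d) (m<n⇒m%n≡m x<d))) x<d) ⟩
    k * d / d + x / d      ≡⟨ cong₂ _+_ (m*n/n≡m k d) (m<n⇒m/n≡0 x<d) ⟩
    k + 0                  ≡⟨ +-identityʳ k ⟩
    k                      ∎

  [k*d+x]%d≡x : ∀ k x d .{{_ : NonZero d}} → x < d → (k * d + x) % d ≡ x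
  [k*d+x]%d≡x k x d x<d =
    trans (cong (_% d) (+-comm (k * d) x)) (trans ([m+kn]%n≡m%n x k d) (m<n⇒m%n≡m x<d))

  m≤n⇒n+m≤2*n : ∀ {m n} → m ≤ n → n + m ≤ 2 * n
  m≤n⇒n+m≤2*n {m} {n} m≤n = subst (n + m ≤_) (cong (n +_) (sym (+-identityʳ n))) (+-monoʳ-≤ n m≤n)

  [m*n]^k≡m^k*n^k : ∀ k m n → (m * n) ^ k ≡ m ^ k * n ^ k
  [m*n]^k≡m^k*n^k zero    m n = refl
  [m*n]^k≡m^k*n^k (suc k) m n = begin-equality
    m * n * (m * n) ^ k       ≡⟨ cong (m * n *_) ([m*n]^k≡m^k*n^k k m n) ⟩
    m * n * (m ^ k * n ^ k)   ≡⟨ reorder m n (m ^ k) (n ^ k) ⟩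
    m * m ^ k * (n * n ^ k)   ∎
    where
    reorder : ∀ a b x y → a * b * (x * y) ≡ a * x * (b * y)
    reorder = solve-∀

  rearrangement : ∀ x y x′ y′ → (x ≤ y × x′ ≤ y′) ⊎ (y ≤ x × y′ ≤ x′) →
                  x * y′ + x′ * y ≤ x * x′ + y * y′
  rearrangement x y x′ y′ (inj₁ (x≤y , x′≤y′)) = sorted x≤y x′≤y′
    where
    sorted : ∀ {x y x′ y′} → x ≤ y → x′ ≤ y′ → x * y′ + x′ * y ≤ x * x′ + y * y′
    sorted {x} {y} {x′} {y′} x≤y x′≤y′ with m≤n⇒∃[o]m+o≡n x≤y | m≤n⇒∃[o]m+o≡n x′≤y′
    ... | d , refl | e , refl = begin
      x * (x′ + e) + x′ * (x + d)                   ≤⟨ m≤m+n _ (d * e) ⟩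
      x * (x′ + e) + x′ * (x + d) + d * e           ≡⟨ expand x d x′ e ⟩
      x * x′ + (x + d) * (x′ + e)                   ∎
      where
      expand : ∀ x d x′ e → x * (x′ + e) + x′ * (x + d) + d * e ≡ x * x′ + (x + d) * (x′ + e)
      expand = solve-∀
  rearrangement x y x′ y′ (inj₂ (y≤x , y′≤x′)) = begin
    x * y′ + x′ * y   ≡⟨ swap x y x′ y′ ⟩
    y * x′ + y′ * x   ≤⟨ rearrangement y x y′ x′ (inj₁ (y≤x , y′≤x′)) ⟩
    y * y′ + x * x′   ≡⟨ +-comm (y * y′) (x * x′) ⟩
    x * x′ + y * y′   ∎
    where
    swap : ∀ x y x′ y′ → x * y′ + x′ * y ≡ y * x′ + y′ * x
    swap = solve-∀

  -- Weighted AM-GM for the weights 1/(k+1) and k/(k+1): the induction step is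
  -- the rearrangement inequality for M, A and their (k+1)-st powers.
  weighted-am-gm : ∀ k M A → suc k * M * A ^ k ≤ M ^ suc k + k * A ^ suc k
  weighted-am-gm zero M A = ≤-reflexive (base M)
    where
    base : ∀ M → 1 * M * 1 ≡ M * 1 + 0
    base = solve-∀
  weighted-am-gm (suc k) M A = +-cancelʳ-≤ (M ^ suc k * A) _ _ (begin
    suc (suc k) * M * (A * A ^ k) + M ^ suc k * A
      ≡⟨ split k M A (A ^ k) (M ^ suc k) ⟩
    suc k * M * A ^ k * A + (M * (A * A ^ k) + M ^ suc k * A)
      ≤⟨ +-mono-≤ (*-monoˡ-≤ A (weighted-am-gm k M A)) (rearrangement M A _ _ powers-sorted) ⟩
    (M ^ suc k + k * (A * A ^ k)) * A + (M * M ^ suc k + A * (A * A ^ k))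
      ≡⟨ merge k M A (A ^ k) (M ^ suc k) ⟩
    M * M ^ suc k + suc k * (A * (A * A ^ k)) + M ^ suc k * A ∎)
    where
    powers-sorted : (M ≤ A × M ^ suc k ≤ A ^ suc k) ⊎ (A ≤ M × A ^ suc k ≤ M ^ suc k)
    powers-sorted with ≤-total M A
    ... | inj₁ M≤A = inj₁ (M≤A , ^-monoˡ-≤ (suc k) M≤A)
    ... | inj₂ A≤M = inj₂ (A≤M , ^-monoˡ-≤ (suc k) A≤M)
    split : ∀ k M A w u → suc (suc k) * M * (A * w) + u * A ≡ suc k * M * w * A + (M * (A * w) + u * A)
    split = solve-∀
    merge : ∀ k M A w u → (u + k * (A * w)) * A + (M * u + A * (A * w)) ≡ M * u + suc k * (A * (A * w)) + u * A
    merge = solve-∀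

  -- x ^ p * (1 - x) ≤ p ^ p / r ^ r on [0,1] (take x = j / (j + d)), from the
  -- weighted AM-GM inequality for p * (j + d) and r * j.
  r^r*j^p*d≤p^p*[j+d]^r : ∀ c j d → let p = suc c; r = suc p in
                           r ^ r * j ^ p * d ≤ p ^ p * (j + d) ^ r
  r^r*j^p*d≤p^p*[j+d]^r c j d = *-cancelˡ-≤ p (+-cancelʳ-≤ (p * (r * j) ^ r) _ _ (begin
    p * (r ^ r * j ^ p * d) + p * (r * j) ^ r          ≡⟨ lhs ⟩
    r * (p * (j + d)) * (r * j) ^ p                    ≤⟨ weighted-am-gm p (p * (j + d)) (r * j) ⟩
    (p * (j + d)) ^ r + p * (r * j) ^ r                 ≡⟨ cong (_+ p * (r * j) ^ r) rhs ⟩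
    p * (p ^ p * (j + d) ^ r) + p * (r * j) ^ r         ∎))
    where
    p = suc c
    r = suc p
    lhs : p * (r ^ r * j ^ p * d) + p * (r * j) ^ r ≡ r * (p * (j + d)) * (r * j) ^ p
    lhs = begin-equality
      p * (r ^ r * j ^ p * d) + p * (r * j * (r * j) ^ p)
        ≡⟨ cong (λ z → p * (r ^ r * j ^ p * d) + p * (r * j * z)) ([m*n]^k≡m^k*n^k p r j) ⟩
      p * (r * r ^ p * j ^ p * d) + p * (r * j * (r ^ p * j ^ p))
        ≡⟨ expand p r j d (r ^ p) (j ^ p) ⟩
      r * (p * (j + d)) * (r ^ p * j ^ p)
        ≡⟨ cong (r * (p * (j + d)) *_) ([m*n]^k≡m^k*n^k p r j) ⟨
      r * (p * (j + d)) * (r * j) ^ p ∎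
      where
      expand : ∀ p r j d x y → p * (r * x * y * d) + p * (r * j * (x * y)) ≡ r * (p * (j + d)) * (x * y)
      expand = solve-∀
    rhs : (p * (j + d)) ^ r ≡ p * (p ^ p * (j + d) ^ r)
    rhs = trans ([m*n]^k≡m^k*n^k r p (j + d)) (*-assoc p (p ^ p) ((j + d) ^ r))

  [a+b]^[1+k]≤a^[1+k]+[1+k]*b*[a+b]^k : ∀ k a b → (a + b) ^ suc k ≤ a ^ suc k + suc k * b * (a + b) ^ k
  [a+b]^[1+k]≤a^[1+k]+[1+k]*b*[a+b]^k zero a b = ≤-reflexive (base a b)
    where
    base : ∀ a b → (a + b) * 1 ≡ a * 1 + 1 * b * 1
    base = solve-∀
  [a+b]^[1+k]≤a^[1+k]+[1+k]*b*[a+b]^k (suc k) a b = begin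
    (a + b) * (a + b) ^ suc k
      ≤⟨ *-monoʳ-≤ (a + b) ([a+b]^[1+k]≤a^[1+k]+[1+k]*b*[a+b]^k k a b) ⟩
    (a + b) * (a ^ suc k + suc k * b * (a + b) ^ k)
      ≡⟨ expand a b (a ^ suc k) ((a + b) ^ k) k ⟩
    a * a ^ suc k + suc k * b * ((a + b) * (a + b) ^ k) + b * a ^ suc k
      ≤⟨ +-monoʳ-≤ _ (*-monoʳ-≤ b (^-monoˡ-≤ (suc k) (m≤m+n a b))) ⟩
    a * a ^ suc k + suc k * b * ((a + b) * (a + b) ^ k) + b * (a + b) ^ suc k
      ≡⟨ collect a b (a ^ suc k) ((a + b) ^ k) k ⟩
    a * a ^ suc k + suc (suc k) * b * ((a + b) * (a + b) ^ k) ∎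
    where
    expand : ∀ a b x y k → (a + b) * (x + suc k * b * y) ≡ a * x + suc k * b * ((a + b) * y) + b * x
    expand = solve-∀
    collect : ∀ a b x y k → a * x + suc k * b * ((a + b) * y) + b * ((a + b) * y) ≡ a * x + suc (suc k) * b * ((a + b) * y)
    collect = solve-∀

  apex-count-bound : ∀ c m J q → J < m → let p = suc c; r = suc p in
    r ^ r * ((m * q ∸ J * q) * (suc J * q) ^ p) ≤ p ^ p * (m * q) ^ r + r ^ r * ((m * q) ^ p * q)
  apex-count-bound c m J q J<m with m≤n⇒∃[o]m+o≡n J<m
  ... | d , refl = begin
    r ^ r * ((M * q ∸ J * q) * (suc J * q) ^ p)
      ≡⟨ cong (λ z → r ^ r * (z * (suc J * q) ^ p)) (*-distribʳ-∸ q M J) ⟨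
    r ^ r * ((M ∸ J) * q * (suc J * q) ^ p)
      ≡⟨ cong₂ (λ z w → r ^ r * (z * q * w)) M∸J≡1+d ([m*n]^k≡m^k*n^k p (suc J) q) ⟩
    r ^ r * (suc d * q * (suc J ^ p * q ^ p))
      ≡⟨ split (r ^ r) (suc J ^ p) d q (q ^ p) ⟩
    r ^ r * suc J ^ p * d * (q * q ^ p) + r ^ r * (suc J ^ p * (q * q ^ p))
      ≤⟨ +-mono-≤ (*-monoˡ-≤ (q * q ^ p) (r^r*j^p*d≤p^p*[j+d]^r c (suc J) d))
                  (*-monoʳ-≤ (r ^ r) (*-monoˡ-≤ (q * q ^ p) (^-monoˡ-≤ p (m≤m+n (suc J) d)))) ⟩
    p ^ p * M ^ r * (q * q ^ p) + r ^ r * (M ^ p * (q * q ^ p))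
      ≡⟨ regroup (p ^ p) (M ^ r) q (q ^ p) (r ^ r) (M ^ p) ⟩
    p ^ p * (M ^ r * q ^ r) + r ^ r * (M ^ p * q ^ p * q)
      ≡⟨ cong₂ (λ u v → p ^ p * u + r ^ r * (v * q)) ([m*n]^k≡m^k*n^k r M q) ([m*n]^k≡m^k*n^k p M q) ⟨
    p ^ p * (M * q) ^ r + r ^ r * ((M * q) ^ p * q) ∎
    where
    p = suc c
    r = suc p
    M = suc J + d
    M∸J≡1+d : M ∸ J ≡ suc d
    M∸J≡1+d = trans (cong (_∸ J) (sym (+-suc J d))) (m+n∸m≡n J (suc d))
    split : ∀ a b d q s → a * (suc d * q * (b * s)) ≡ a * b * d * (q * s) + a * (b * (q * s))
    split = solve-∀
    regroup : ∀ P M q s R Mp → P * M * (q * s) + R * (Mp * (q * s)) ≡ P * (M * (q * s)) + R * (Mp * s * q)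
    regroup = solve-∀

  block-size-power-bound : ∀ c T m t → T ≤ t + m → m ≤ t → let p = suc c; r = suc p in
                           T ^ r ≤ t ^ r + r * m * (2 * t) ^ p
  block-size-power-bound c T m t T≤t+m m≤t = begin
    T ^ r                          ≤⟨ ^-monoˡ-≤ r T≤t+m ⟩
    (t + m) ^ r                    ≤⟨ [a+b]^[1+k]≤a^[1+k]+[1+k]*b*[a+b]^k p t m ⟩
    t ^ r + r * m * (t + m) ^ p    ≤⟨ +-monoʳ-≤ (t ^ r) (*-monoʳ-≤ (r * m) (^-monoˡ-≤ p (m≤n⇒n+m≤2*n m≤t))) ⟩
    t ^ r + r * m * (2 * t) ^ p    ∎
    where
    p = suc c
    r = suc p

  binomial-error-bound : ∀ c den m t → let p = suc c; r = suc p in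
    2 * den * p ^ p * r * m * 2 ^ p ≤ t → 2 * (den * p ^ p * (r * m * (2 * t) ^ p)) ≤ r ^ r * t ^ r
  binomial-error-bound c den m t t-large = begin
    2 * (den * p ^ p * (r * m * (2 * t) ^ p))
      ≡⟨ cong (λ z → 2 * (den * p ^ p * (r * m * z))) ([m*n]^k≡m^k*n^k p 2 t) ⟩
    2 * (den * p ^ p * (r * m * (2 ^ p * t ^ p)))
      ≡⟨ regroup den (p ^ p) r m (2 ^ p) (t ^ p) ⟩
    2 * den * p ^ p * r * m * 2 ^ p * t ^ p
      ≤⟨ *-monoˡ-≤ (t ^ p) t-large ⟩
    t ^ r
      ≤⟨ m≤n*m (t ^ r) (r ^ r) {{m^n≢0 r r}} ⟩
    r ^ r * t ^ r ∎
    where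
    p = suc c
    r = suc p
    regroup : ∀ d P r m b T → 2 * (d * P * (r * m * (b * T))) ≡ 2 * d * P * r * m * b * T
    regroup = solve-∀

  child-error-bound : ∀ c den m t q .{{_ : NonZero m}} → let p = suc c; r = suc p in
    m * q ≤ 2 * t → m ≤ t → 6 * 2 ^ p * den ≤ m →
    2 * (den * (r ^ r * ((m * q) ^ p * suc q))) ≤ r ^ r * t ^ r
  child-error-bound c den m t q mq≤2t m≤t m-large = *-cancelˡ-≤ m (begin
    m * (2 * (den * (r ^ r * ((m * q) ^ p * suc q))))
      ≡⟨ regroup m den (r ^ r) ((m * q) ^ p) q ⟩
    2 * den * r ^ r * (m * q) ^ p * (m * q + m)
      ≤⟨ *-mono-≤ (*-monoʳ-≤ (2 * den * r ^ r) (^-monoˡ-≤ p mq≤2t)) (+-mono-≤ mq≤2t m≤t) ⟩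
    2 * den * r ^ r * (2 * t) ^ p * (2 * t + t)
      ≡⟨ cong (λ z → 2 * den * r ^ r * z * (2 * t + t)) ([m*n]^k≡m^k*n^k p 2 t) ⟩
    2 * den * r ^ r * (2 ^ p * t ^ p) * (2 * t + t)
      ≡⟨ collect den (r ^ r) (2 ^ p) (t ^ p) t ⟩
    6 * 2 ^ p * den * (r ^ r * (t * t ^ p))
      ≤⟨ *-monoˡ-≤ _ m-large ⟩
    m * (r ^ r * t ^ r) ∎)
    where
    p = suc c
    r = suc p
    regroup : ∀ m d R X q → m * (2 * (d * (R * (X * suc q)))) ≡ 2 * d * R * X * (m * q + m)
    regroup = solve-∀
    collect : ∀ d R b T t → 2 * d * R * (b * T) * (2 * t + t) ≡ 6 * b * d * (R * (t * T))
    collect = solve-∀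

  -- F bounds the edges with apex in a block, T ^ p those with a foot in it.  The
  -- main term p ^ p * T ^ r comes from F; everything else is absorbed into one
  -- extra r ^ r * t ^ r, i.e. into ε * t ^ r with ε = 1 / den.
  edge-count-bound : ∀ c den m t q F E .{{_ : NonZero m}} → let p = suc c; r = suc p; T = m * q in
    T ≤ t + m → m ≤ t → 6 * 2 ^ p * den ≤ m → 2 * den * p ^ p * r * m * 2 ^ p ≤ t →
    r ^ r * F ≤ p ^ p * T ^ r + r ^ r * (T ^ p * q) → E ≤ F + T ^ p →
    r ^ r * den * E ≤ (p ^ p * den + r ^ r) * t ^ r
  edge-count-bound c den m t q F E T≤t+m m≤t m-large t-large apex E≤ = begin
    r ^ r * den * E
      ≤⟨ *-monoʳ-≤ (r ^ r * den) E≤ ⟩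
    r ^ r * den * (F + T ^ p)
      ≡⟨ distribute (r ^ r) den F (T ^ p) ⟩
    den * (r ^ r * F) + den * (r ^ r * T ^ p)
      ≤⟨ +-monoˡ-≤ _ (*-monoʳ-≤ den apex) ⟩
    den * (p ^ p * T ^ r + r ^ r * (T ^ p * q)) + den * (r ^ r * T ^ p)
      ≡⟨ collect den (p ^ p) (T ^ r) (r ^ r) (T ^ p) q ⟩
    den * p ^ p * T ^ r + child
      ≤⟨ +-monoˡ-≤ child (*-monoʳ-≤ (den * p ^ p) (block-size-power-bound c T m t T≤t+m m≤t)) ⟩
    den * p ^ p * (t ^ r + r * m * (2 * t) ^ p) + child
      ≡⟨ split den (p ^ p) (t ^ r) (r * m * (2 * t) ^ p) child ⟩
    p ^ p * den * t ^ r + (binomial + child)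
      ≤⟨ +-monoʳ-≤ (p ^ p * den * t ^ r) (halves binomial child (r ^ r * t ^ r)
           (binomial-error-bound c den m t t-large)
           (child-error-bound c den m t q (≤-trans T≤t+m (m≤n⇒n+m≤2*n m≤t)) m≤t m-large)) ⟩
    p ^ p * den * t ^ r + r ^ r * t ^ r
      ≡⟨ *-distribʳ-+ (t ^ r) (p ^ p * den) (r ^ r) ⟨
    (p ^ p * den + r ^ r) * t ^ r ∎
    where
    p = suc c
    r = suc p
    T = m * q
    binomial = den * p ^ p * (r * m * (2 * t) ^ p)
    child = den * (r ^ r * (T ^ p * suc q))
    halves : ∀ A B R → 2 * A ≤ R → 2 * B ≤ R → A + B ≤ R
    halves A B R 2A≤R 2B≤R = *-cancelˡ-≤ 2 (begin
      2 * (A + B)      ≡⟨ *-distribˡ-+ 2 A B ⟩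
      2 * A + 2 * B    ≤⟨ +-mono-≤ 2A≤R 2B≤R ⟩
      R + R            ≡⟨ cong (R +_) (+-identityʳ R) ⟨
      2 * R            ∎)
    distribute : ∀ R d F Y → R * d * (F + Y) ≡ d * (R * F) + d * (R * Y)
    distribute = solve-∀
    collect : ∀ d P Tr R Tp q → d * (P * Tr + R * (Tp * q)) + d * (R * Tp) ≡ d * P * Tr + d * (R * (Tp * suc q))
    collect = solve-∀
    split : ∀ d P tr Z B → d * P * (tr + Z) + B ≡ P * d * tr + (d * P * Z + B)
    split = solve-∀

module RationalBounds where

  open import Data.Nat as ℕ using (ℕ; zero; suc; _^_; NonZero)
  import Data.Nat.Properties as ℕ
  open import Data.Nat.Tactic.RingSolver using (solve-∀)
  open import Data.Integer as ℤ using (+_; +[1+_]; -[1+_])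
  import Data.Integer.Properties as ℤ
  open import Data.Rational as ℚ using (ℚ; mkℚ; 0ℚ; _+_; _*_; _/_; toℚᵘ)
  import Data.Rational.Properties as ℚ
  open import Data.Rational.Unnormalised as ℚᵘ using (ℚᵘ; mkℚᵘ; *≤*; _≃_)
  import Data.Rational.Unnormalised.Properties as ℚᵘ
  open import Data.Product using (∃; _,_)
  open import Relation.Binary.PropositionalEquality

  toℚᵘ-/ : ∀ a d .{{_ : NonZero d}} → toℚᵘ (+ a / d) ≃ + a ℚᵘ./ d
  toℚᵘ-/ a (suc d) = ℚ.toℚᵘ-fromℚᵘ (mkℚᵘ (+ a) d)

  0<ε⇒1/[1+d]≤ε : ∀ ε → 0ℚ ℚ.< ε → ∃ λ d → + 1 / suc d ℚ.≤ ε
  0<ε⇒1/[1+d]≤ε (mkℚ (+ zero) d _) (ℚ.*<* (ℤ.+<+ ()))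
  0<ε⇒1/[1+d]≤ε (mkℚ -[1+ k ] d _) (ℚ.*<* ())
  0<ε⇒1/[1+d]≤ε (mkℚ +[1+ k ] d _) _ =
    d , ℚ.toℚᵘ-cancel-≤ (ℚᵘ.≤-respˡ-≃ (ℚᵘ.≃-sym (toℚᵘ-/ 1 (suc d)))
          (*≤* (ℤ.*-monoʳ-≤-nonNeg (+ suc d) {+ 1} {+[1+ k ]} (ℤ.+≤+ (ℕ.s≤s ℕ.z≤n)))))

  ≤-fraction-sum : ∀ a R D .{{_ : NonZero R}} .{{_ : NonZero D}} E t →
    R ℕ.* D ℕ.* E ℕ.≤ (a ℕ.* D ℕ.+ R) ℕ.* t →
    + E / 1 ℚ.≤ (+ a / R + + 1 / D) * (+ t / 1)
  ≤-fraction-sum a R@(suc _) D@(suc _) E t RDE≤ =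
    ℚ.toℚᵘ-cancel-≤ (ℚᵘ.≤-respˡ-≃ (ℚᵘ.≃-sym (toℚᵘ-/ E 1)) (ℚᵘ.≤-respʳ-≃ (ℚᵘ.≃-sym unnormalise) cross))
    where
    unnormalise : toℚᵘ ((+ a / R + + 1 / D) * (+ t / 1)) ≃ (+ a ℚᵘ./ R ℚᵘ.+ + 1 ℚᵘ./ D) ℚᵘ.* (+ t ℚᵘ./ 1)
    unnormalise = ℚᵘ.≃-trans (ℚ.toℚᵘ-homo-* (+ a / R + + 1 / D) (+ t / 1))
      (ℚᵘ.*-cong (ℚᵘ.≃-trans (ℚ.toℚᵘ-homo-+ (+ a / R) (+ 1 / D)) (ℚᵘ.+-cong (toℚᵘ-/ a R) (toℚᵘ-/ 1 D)))
                 (toℚᵘ-/ t 1))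
    cross : + E ℚᵘ./ 1 ℚᵘ.≤ (+ a ℚᵘ./ R ℚᵘ.+ + 1 ℚᵘ./ D) ℚᵘ.* (+ t ℚᵘ./ 1)
    cross = *≤* (subst₂ ℤ._≤_ (ℤ.pos-* E (R ℕ.* D ℕ.* 1)) integral (ℤ.+≤+ (subst₂ ℕ._≤_ (lhs E R D) (rhs a R D t) RDE≤)))
      where
      lhs : ∀ E R D → R ℕ.* D ℕ.* E ≡ E ℕ.* (R ℕ.* D ℕ.* 1)
      lhs = solve-∀
      rhs : ∀ a R D t → (a ℕ.* D ℕ.+ R) ℕ.* t ≡ (a ℕ.* D ℕ.+ 1 ℕ.* R) ℕ.* t ℕ.* 1
      rhs = solve-∀
      integral : + ((a ℕ.* D ℕ.+ 1 ℕ.* R) ℕ.* t ℕ.* 1) ≡ ((+ a ℤ.* + D ℤ.+ + 1 ℤ.* + R) ℤ.* + t) ℤ.* + 1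
      integral = begin
        + ((a ℕ.* D ℕ.+ 1 ℕ.* R) ℕ.* t ℕ.* 1)             ≡⟨ ℤ.pos-* ((a ℕ.* D ℕ.+ 1 ℕ.* R) ℕ.* t) 1 ⟩
        + ((a ℕ.* D ℕ.+ 1 ℕ.* R) ℕ.* t) ℤ.* + 1           ≡⟨ cong (ℤ._* + 1) (ℤ.pos-* (a ℕ.* D ℕ.+ 1 ℕ.* R) t) ⟩
        + (a ℕ.* D ℕ.+ 1 ℕ.* R) ℤ.* + t ℤ.* + 1           ≡⟨ cong (λ z → z ℤ.* + t ℤ.* + 1) (ℤ.pos-+ (a ℕ.* D) (1 ℕ.* R)) ⟩
        (+ (a ℕ.* D) ℤ.+ + (1 ℕ.* R)) ℤ.* + t ℤ.* + 1     ≡⟨ cong₂ (λ u v → (u ℤ.+ v) ℤ.* + t ℤ.* + 1) (ℤ.pos-* a D) (ℤ.pos-* 1 R) ⟩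
        (+ a ℤ.* + D ℤ.+ + 1 ℤ.* + R) ℤ.* + t ℤ.* + 1     ∎
        where open ≡-Reasoning

  ≤-threshold+ε : ∀ c ε → 0ℚ ℚ.< ε → let p = suc c; r = suc p in
    ∃ λ den → ∀ E t → r ^ r ℕ.* suc den ℕ.* E ℕ.≤ (p ^ p ℕ.* suc den ℕ.+ r ^ r) ℕ.* t →
    + E / 1 ℚ.≤ (threshold r + ε) * (+ t / 1)
  ≤-threshold+ε c ε 0<ε with 0<ε⇒1/[1+d]≤ε ε 0<ε
  ... | d , 1/den≤ε = d , λ E t bound → ℚ.≤-trans
    (≤-fraction-sum (p ^ p) (r ^ r) (suc d) {{ℕ.m^n≢0 r r}} E t bound)
    (ℚ.*-monoʳ-≤-nonNeg (+ t / 1) {{ℚ.normalize-nonNeg t 1}} (ℚ.+-monoʳ-≤ (threshold r) 1/den≤ε))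
    where
    p = suc c
    r = suc p

module Lists where

  open import Data.Nat using (ℕ; zero; suc; _+_; _*_; _∸_; _^_; _≤_; _<_; z≤n; s≤s)
  open import Data.Nat.Properties
  open import Data.List using (List; []; _∷_; [_]; length; map; concatMap; applyUpTo; upTo)
  open import Data.List.Properties using (length-++; length-map; length-applyUpTo; length-upTo; length-removeAt′)
  open import Data.List.Membership.Propositional using (_∈_; find; lose)
  open import Data.List.Membership.Propositional.Properties
    using (∈-concatMap⁺; ∈-concatMap⁻; ∈-map⁺; ∈-map⁻; ∈-applyUpTo⁺; ∈-applyUpTo⁻; ∈-upTo⁺; ∈-upTo⁻)
  open import Data.List.Relation.Unary.Any using (here; there; _─_)
  open import Data.List.Relation.Unary.All as All using (All; []; _∷_)
  open import Data.List.Relation.Unary.AllPairs using (AllPairs; _∷_)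
  open import Data.List.Relation.Unary.Unique.Propositional using (Unique)
  open import Data.Product using (∃; _×_; _,_)
  open import Data.Sum using (_⊎_; inj₁; inj₂)
  open import Data.Empty using (⊥-elim)
  open import Relation.Binary.PropositionalEquality hiding ([_])

  private variable
    A B : Set

  ∈-─⁺ : ∀ {x z : A} {ys} (x∈ys : x ∈ ys) → z ∈ ys → z ≢ x → z ∈ (ys ─ x∈ys)
  ∈-─⁺ (here refl) (here refl)  z≢x = ⊥-elim (z≢x refl)
  ∈-─⁺ (here refl) (there z∈ys) z≢x = z∈ys
  ∈-─⁺ (there x∈ys) (here refl)  z≢x = here refl
  ∈-─⁺ (there x∈ys) (there z∈ys) z≢x = there (∈-─⁺ x∈ys z∈ys z≢x)

  Unique-⊆⇒length≤ : ∀ {xs ys : List A} → Unique xs → (∀ {z} → z ∈ xs → z ∈ ys) → length xs ≤ length ys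
  Unique-⊆⇒length≤ {xs = []} _ _ = z≤n
  Unique-⊆⇒length≤ {xs = x ∷ xs} {ys} (x∉xs ∷ unique) xs⊆ys =
    subst (suc (length xs) ≤_) (sym (length-removeAt′ ys _)) (s≤s (Unique-⊆⇒length≤ unique
      λ z∈xs → ∈-─⁺ x∈ys (xs⊆ys (there z∈xs)) λ z≡x → All.lookup x∉xs z∈xs (sym z≡x)))
    where
    x∈ys = xs⊆ys (here refl)

  AllPairs-∈ : ∀ {R : A → A → Set} {xs u w} → AllPairs R xs → u ∈ xs → w ∈ xs → u ≡ w ⊎ R u w ⊎ R w u
  AllPairs-∈ (_ ∷ _)           (here refl) (here refl) = inj₁ refl
  AllPairs-∈ (u-related ∷ _)   (here refl) (there w∈) = inj₂ (inj₁ (All.lookup u-related w∈))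
  AllPairs-∈ (w-related ∷ _)   (there u∈) (here refl) = inj₂ (inj₂ (All.lookup w-related u∈))
  AllPairs-∈ (_ ∷ all-related) (there u∈) (there w∈) = AllPairs-∈ all-related u∈ w∈

  length-concatMap : ∀ (f : A → List B) {k} → (∀ x → length (f x) ≡ k) →
                     ∀ xs → length (concatMap f xs) ≡ length xs * k
  length-concatMap f lengths []       = refl
  length-concatMap f lengths (x ∷ xs) =
    trans (length-++ (f x)) (cong₂ _+_ (lengths x) (length-concatMap f lengths xs))

  ∈-concatMap⁺′ : ∀ {f : A → List B} {x y xs} → x ∈ xs → y ∈ f x → y ∈ concatMap f xs
  ∈-concatMap⁺′ {f = f} x∈xs y∈fx = ∈-concatMap⁺ f (lose x∈xs y∈fx)

  ∈-concatMap⁻′ : ∀ (f : A → List B) {y xs} → y ∈ concatMap f xs → ∃ λ x → x ∈ xs × y ∈ f x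
  ∈-concatMap⁻′ f y∈ = find (∈-concatMap⁻ f y∈)

  range : ℕ → ℕ → List ℕ
  range a b = applyUpTo (a +_) (b ∸ a)

  length-range : ∀ a b → length (range a b) ≡ b ∸ a
  length-range a b = length-applyUpTo (a +_) (b ∸ a)

  ∈-range⁺ : ∀ {a b x} → a ≤ x → x < b → x ∈ range a b
  ∈-range⁺ {a} {b} {x} a≤x x<b =
    subst (_∈ range a b) (m+[n∸m]≡n a≤x) (∈-applyUpTo⁺ (a +_) (∸-monoˡ-< x<b a≤x))

  ∈-range⁻ : ∀ {a b x} → x ∈ range a b → a ≤ x × x < b
  ∈-range⁻ {a} {b} x∈ with ∈-applyUpTo⁻ (a +_) x∈
  ... | i , i<b∸a , refl = m≤m+n a i , (begin-strict
    a + i             <⟨ +-monoʳ-< a i<b∸a ⟩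
    a + (b ∸ a)       ≡⟨ m+[n∸m]≡n {a} (<⇒≤ (m∸n≢0⇒n<m {b} (m>n⇒m∸n≢0 (≤-trans (s≤s z≤n) i<b∸a)))) ⟩
    b                 ∎)
    where open ≤-Reasoning

  tuples : ℕ → ℕ → List (List ℕ)
  tuples zero    B = [ [] ]
  tuples (suc l) B = concatMap (λ x → map (x ∷_) (tuples l B)) (upTo B)

  length-tuples : ∀ l B → length (tuples l B) ≡ B ^ l
  length-tuples zero    B = refl
  length-tuples (suc l) B = trans
    (length-concatMap _ (λ x → trans (length-map (x ∷_) (tuples l B)) (length-tuples l B)) (upTo B))
    (cong (_* B ^ l) (length-upTo B))

  ∈-tuples⁺ : ∀ l B xs → length xs ≡ l → All (_< B) xs → xs ∈ tuples l B
  ∈-tuples⁺ zero    B []       refl []          = here refl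
  ∈-tuples⁺ (suc l) B (x ∷ xs) refl (x<B ∷ xs<B) =
    ∈-concatMap⁺′ (∈-upTo⁺ x<B) (∈-map⁺ (x ∷_) (∈-tuples⁺ l B xs refl xs<B))

  ∈-tuples⁻ : ∀ l B xs → xs ∈ tuples l B → length xs ≡ l × All (_< B) xs
  ∈-tuples⁻ zero    B [] (here refl) = refl , []
  ∈-tuples⁻ (suc l) B ys ys∈ with ∈-concatMap⁻′ _ {xs = upTo B} ys∈
  ... | x , x∈ , ys∈′ with ∈-map⁻ (x ∷_) ys∈′
  ... | xs , xs∈ , refl with ∈-tuples⁻ l B xs xs∈
  ... | length≡l , xs<B = cong suc length≡l , ∈-upTo⁻ x∈ ∷ xs<B

module NatSubsets where

  open import Data.Nat using (ℕ; zero; suc; _<_; s≤s)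
  open import Data.Fin using (Fin; toℕ)
  open import Data.Fin.Subset using (Subset; ⊥; _∪_; ∣_∣; _∈_; inside; outside)
  open import Data.Fin.Subset.Properties using (∉⊥; ∣⊥∣≡0; x∈p∪q⁻; ∪-identityˡ)
  open import Data.Vec using ([]; _∷_; here; there)
  open import Data.List using (List; []; _∷_; length; foldr)
  open import Data.List.Relation.Unary.Any using () renaming (here to hereₗ; there to thereₗ)
  open import Data.List.Relation.Unary.All as All using (All; _∷_)
  open import Data.List.Relation.Unary.AllPairs using (_∷_)
  open import Data.List.Relation.Unary.Unique.Propositional using (Unique)
  import Data.List.Membership.Propositional as List
  open import Data.Sum using (inj₁; inj₂)
  open import Data.Empty using (⊥-elim)
  open import Function using (_∘_)
  open import Relation.Binary.PropositionalEquality

  -- Empty when v ≥ N.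
  ⁅_⁆ℕ : ∀ {N} → ℕ → Subset N
  ⁅_⁆ℕ {zero}  _       = []
  ⁅_⁆ℕ {suc N} zero    = inside ∷ ⊥
  ⁅_⁆ℕ {suc N} (suc v) = outside ∷ ⁅ v ⁆ℕ

  x∈⁅v⁆ℕ⇒toℕx≡v : ∀ {N v} {x : Fin N} → x ∈ ⁅ v ⁆ℕ → toℕ x ≡ v
  x∈⁅v⁆ℕ⇒toℕx≡v {v = zero}  here       = refl
  x∈⁅v⁆ℕ⇒toℕx≡v {v = zero}  (there x∈) = ⊥-elim (∉⊥ x∈)
  x∈⁅v⁆ℕ⇒toℕx≡v {v = suc v} (there x∈) = cong suc (x∈⁅v⁆ℕ⇒toℕx≡v x∈)

  ∣⁅v⁆ℕ∪p∣ : ∀ {N v} (p : Subset N) → v < N → (∀ {x} → x ∈ p → toℕ x ≢ v) → ∣ ⁅ v ⁆ℕ ∪ p ∣ ≡ suc ∣ p ∣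
  ∣⁅v⁆ℕ∪p∣ {v = zero}  (inside  ∷ p) _ v∉p = ⊥-elim (v∉p here refl)
  ∣⁅v⁆ℕ∪p∣ {v = zero}  (outside ∷ p) _ v∉p = cong (λ q → suc ∣ q ∣) (∪-identityˡ p)
  ∣⁅v⁆ℕ∪p∣ {v = suc v} (inside  ∷ p) (s≤s v<N) v∉p = cong suc (∣⁅v⁆ℕ∪p∣ p v<N (λ x∈ → v∉p (there x∈) ∘ cong suc))
  ∣⁅v⁆ℕ∪p∣ {v = suc v} (outside ∷ p) (s≤s v<N) v∉p = ∣⁅v⁆ℕ∪p∣ p v<N (λ x∈ → v∉p (there x∈) ∘ cong suc)

  fromList : ∀ {N} → List ℕ → Subset N
  fromList = foldr (λ v p → ⁅ v ⁆ℕ ∪ p) ⊥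

  ∈-fromList⁻ : ∀ {N vs} {x : Fin N} → x ∈ fromList vs → toℕ x List.∈ vs
  ∈-fromList⁻ {vs = []}     x∈ = ⊥-elim (∉⊥ x∈)
  ∈-fromList⁻ {vs = v ∷ vs} x∈ with x∈p∪q⁻ ⁅ v ⁆ℕ (fromList vs) x∈
  ... | inj₁ x∈v  = hereₗ (x∈⁅v⁆ℕ⇒toℕx≡v x∈v)
  ... | inj₂ x∈vs = thereₗ (∈-fromList⁻ x∈vs)

  ∣fromList∣ : ∀ {N vs} → Unique vs → All (_< N) vs → ∣ fromList {N} vs ∣ ≡ length vs
  ∣fromList∣ {N} {[]}     _               _            = ∣⊥∣≡0 N
  ∣fromList∣ {N} {v ∷ vs} (v∉vs ∷ unique) (v<N ∷ vs<N) = trans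
    (∣⁅v⁆ℕ∪p∣ (fromList vs) v<N λ x∈ x≡v → All.lookup v∉vs (subst (List._∈ vs) x≡v (∈-fromList⁻ x∈)) refl)
    (cong suc (∣fromList∣ unique vs<N))

-- The blocks, of T = m * q vertices each, form a tree of depth m: block number
-- j * W + β is the β-th block of level j, and the block (j , β) with j < m has,
-- for every position w < T, a group of p children (j + 1 , D * β + w * p + k),
-- k < p.  An edge takes the vertex at a high position w ≥ j * q of (j , β) and
-- one vertex at a low position < (j + 1) * q in each child of the group of w.
module Construction (c a b : ℕ) where

  open Arithmetic using ([k*d+x]/d≡k; [k*d+x]%d≡x; apex-count-bound)
  open Lists
  open NatSubsets

  open import Data.Nat using (zero; suc; _+_; _*_; _∸_; _^_; _≤_; _<_; _<?_; z≤n; s≤s; NonZero; _/_; _%_)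
  open import Data.Nat.Properties
  open import Data.Nat.DivMod using (m%n<n; m≡m%n+[m/n]*n; m<n*o⇒m/o<n)
  open import Data.Bool using () renaming (_≟_ to _≟ᵇ_)
  open import Data.Fin as Fin using (Fin; toℕ; fromℕ<)
  open import Data.Fin.Properties using (toℕ-fromℕ<; toℕ-injective; toℕ<n; any?)
  open import Data.Fin.Subset.Properties using (_∈?_)
  open import Relation.Nullary.Decidable using (_×-dec_)
  open import Data.Fin.Subset using (Subset; ∣_∣) renaming (_∈_ to _∈ₛ_)
  open import Data.Vec.Properties using (≡-dec)
  open import Data.List using (List; []; _∷_; length; map; concatMap; applyUpTo; upTo; _++_; filter; allFin; deduplicate)
  open import Data.List.Properties using (length-map; length-++; length-upTo; length-applyUpTo)
  open import Data.List.Membership.Propositional using (_∈_)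
  open import Data.List.Membership.Propositional.Properties
    using (∈-map⁺; ∈-map⁻; ∈-upTo⁺; ∈-upTo⁻; ∈-++⁺ˡ; ∈-++⁺ʳ; ∈-filter⁺; ∈-filter⁻; ∈-allFin; ∈-deduplicate⁺; ∈-deduplicate⁻)
  open import Data.List.Relation.Unary.Unique.Propositional using (Unique)
  import Data.List.Relation.Unary.Unique.Propositional.Properties as Unique
  open import Data.List.Relation.Unary.Unique.DecPropositional.Properties using (deduplicate-!)
  open import Data.List.Relation.Unary.Any using (here; there)
  open import Data.List.Relation.Unary.All as All using (All; []; _∷_)
  open import Data.List.Relation.Unary.All.Properties using (applyUpTo⁺₁)
  open import Data.List.Relation.Unary.AllPairs as AllPairs using (AllPairs; []; _∷_)
  open import Data.Product using (∃; _×_; _,_)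
  open import Data.Sum using (inj₁; inj₂)
  open import Data.Empty using (⊥-elim)
  open import Function using (_∘_)
  open import Relation.Nullary using (¬_; yes; no)
  open import Relation.Binary.PropositionalEquality

  p = suc c
  r = suc p
  m = suc a
  q = suc b
  T = m * q
  D = T * p
  W = D ^ m

  instance
    W≢0 : NonZero W
    W≢0 = m^n≢0 D m

  vertex : ℕ → ℕ → ℕ
  vertex B x = B * T + x

  levelBlock : ℕ → ℕ → ℕ
  levelBlock j β = j * W + β

  placed : (ℕ → ℕ) → List ℕ → List ℕ
  placed blk []       = []
  placed blk (x ∷ xs) = vertex (blk 0) x ∷ placed (blk ∘ suc) xs

  record EdgeCode : Set where
    constructor edgeCode
    field
      level index apex : ℕ
      feet : List ℕ
  open EdgeCode

  apexBlock : EdgeCode → ℕ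
  apexBlock e = levelBlock (level e) (index e)

  childIndex : EdgeCode → ℕ → ℕ
  childIndex e k = D * index e + (apex e * p + k)

  childBlock : EdgeCode → ℕ → ℕ
  childBlock e k = levelBlock (suc (level e)) (childIndex e k)

  vertices : EdgeCode → List ℕ
  vertices e = vertex (apexBlock e) (apex e) ∷ placed (childBlock e) (feet e)

  record WellFormed (e : EdgeCode) : Set where
    field
      level<m     : level e < m
      index<D^    : index e < D ^ level e
      apex-high   : level e * q ≤ apex e
      apex<T      : apex e < T
      feet-length : length (feet e) ≡ p
      feet-low    : All (_< suc (level e) * q) (feet e)

  apexCodes : ℕ → ℕ → List EdgeCode
  apexCodes j β = concatMap (λ w → map (edgeCode j β w) (tuples p (suc j * q))) (range (j * q) T)

  edgeCodes : List EdgeCode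
  edgeCodes = concatMap (λ j → concatMap (apexCodes j) (upTo (D ^ j))) (upTo m)

  ∈-apexCodes⁺ : ∀ e → WellFormed e → e ∈ apexCodes (level e) (index e)
  ∈-apexCodes⁺ e wf = ∈-concatMap⁺′ (∈-range⁺ apex-high apex<T)
    (∈-map⁺ (edgeCode (level e) (index e) (apex e)) (∈-tuples⁺ p _ (feet e) feet-length feet-low))
    where open WellFormed wf

  ∈-edgeCodes⁺ : ∀ e → WellFormed e → e ∈ edgeCodes
  ∈-edgeCodes⁺ e wf = ∈-concatMap⁺′ (∈-upTo⁺ (WellFormed.level<m wf))
    (∈-concatMap⁺′ (∈-upTo⁺ (WellFormed.index<D^ wf)) (∈-apexCodes⁺ e wf))

  ∈-edgeCodes⁻ : ∀ {e} → e ∈ edgeCodes → WellFormed e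
  ∈-edgeCodes⁻ e∈ with ∈-concatMap⁻′ _ {xs = upTo m} e∈
  ... | j , j∈ , e∈₁ with ∈-concatMap⁻′ _ {xs = upTo (D ^ j)} e∈₁
  ... | β , β∈ , e∈₂ with ∈-concatMap⁻′ _ {xs = range (j * q) T} e∈₂
  ... | w , w∈ , e∈₃ with ∈-map⁻ (edgeCode j β w) e∈₃
  ... | xs , xs∈ , refl with ∈-range⁻ w∈ | ∈-tuples⁻ p (suc j * q) xs xs∈
  ... | jq≤w , w<T | length≡p , xs-low = record
    { level<m = ∈-upTo⁻ j∈ ; index<D^ = ∈-upTo⁻ β∈ ; apex-high = jq≤w ; apex<T = w<T
    ; feet-length = length≡p ; feet-low = xs-low }

  vertex/T≡block : ∀ B {x} → x < T → vertex B x / T ≡ B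
  vertex/T≡block B {x} = [k*d+x]/d≡k B x T

  D^j≤W : ∀ {j} → j ≤ m → D ^ j ≤ W
  D^j≤W = ^-monoʳ-≤ D

  levelBlock<[1+m]*W : ∀ {j β} → j ≤ m → β < W → levelBlock j β < suc m * W
  levelBlock<[1+m]*W {j} {β} j≤m β<W = begin-strict
    j * W + β    <⟨ +-monoʳ-< (j * W) β<W ⟩
    j * W + W    ≡⟨ +-comm (j * W) W ⟩
    suc j * W    ≤⟨ *-monoˡ-≤ W (s≤s j≤m) ⟩
    suc m * W    ∎
    where open ≤-Reasoning

  childIndex<D^[1+level] : ∀ e {k} → index e < D ^ level e → apex e < T → k < p →
                           childIndex e k < D ^ suc (level e)
  childIndex<D^[1+level] e {k} index< apex<T k<p = begin-strict
    D * index e + (apex e * p + k)   <⟨ +-monoʳ-< (D * index e) (+-monoʳ-< (apex e * p) k<p) ⟩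
    D * index e + (apex e * p + p)   ≤⟨ +-monoʳ-≤ (D * index e) (≤-reflexive (+-comm (apex e * p) p)) ⟩
    D * index e + suc (apex e) * p   ≤⟨ +-monoʳ-≤ (D * index e) (*-monoˡ-≤ p apex<T) ⟩
    D * index e + D                  ≡⟨ trans (+-comm (D * index e) D) (sym (*-suc D (index e))) ⟩
    D * suc (index e)                ≤⟨ *-monoʳ-≤ D index< ⟩
    D ^ suc (level e)                ∎
    where open ≤-Reasoning

  childBlock-injective : ∀ e {k k′} → childBlock e k ≡ childBlock e k′ → k ≡ k′
  childBlock-injective e {k} {k′} =
    +-cancelˡ-≡ (apex e * p) k k′ ∘ +-cancelˡ-≡ (D * index e) _ _ ∘ +-cancelˡ-≡ (suc (level e) * W) _ _

  module _ {e : EdgeCode} (wf : WellFormed e) where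
    open WellFormed wf

    index<W : index e < W
    index<W = <-≤-trans index<D^ (D^j≤W (<⇒≤ level<m))

    childIndex<W : ∀ {k} → k < p → childIndex e k < W
    childIndex<W k<p = <-≤-trans (childIndex<D^[1+level] e index<D^ apex<T k<p) (D^j≤W level<m)

    apexBlock<[1+m]*W : apexBlock e < suc m * W
    apexBlock<[1+m]*W = levelBlock<[1+m]*W (<⇒≤ level<m) index<W

    childBlock<[1+m]*W : ∀ {k} → k < p → childBlock e k < suc m * W
    childBlock<[1+m]*W k<p = levelBlock<[1+m]*W level<m (childIndex<W k<p)

    apexBlock<childBlock : ∀ k → apexBlock e < childBlock e k
    apexBlock<childBlock k = begin-strict
      level e * W + index e      <⟨ +-monoʳ-< (level e * W) index<W ⟩
      level e * W + W            ≡⟨ +-comm (level e * W) W ⟩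
      suc (level e) * W          ≤⟨ m≤m+n (suc (level e) * W) (childIndex e k) ⟩
      childBlock e k             ∎
      where open ≤-Reasoning

  ∈-placed⁻ : ∀ blk xs {y} → y ∈ placed blk xs → ∃ λ i → ∃ λ x → i < length xs × x ∈ xs × y ≡ vertex (blk i) x
  ∈-placed⁻ blk (x ∷ xs) (here refl) = 0 , x , s≤s z≤n , here refl , refl
  ∈-placed⁻ blk (x ∷ xs) (there y∈) with ∈-placed⁻ (blk ∘ suc) xs y∈
  ... | i , x′ , i< , x′∈ , refl = suc i , x′ , s≤s i< , there x′∈ , refl

  ∈-placed-applyUpTo⁻ : ∀ blk f L {y} → y ∈ placed blk (applyUpTo f L) → ∃ λ i → i < L × y ≡ vertex (blk i) (f i)
  ∈-placed-applyUpTo⁻ blk f (suc L) (here refl) = 0 , s≤s z≤n , refl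
  ∈-placed-applyUpTo⁻ blk f (suc L) (there y∈) with ∈-placed-applyUpTo⁻ (blk ∘ suc) (f ∘ suc) L y∈
  ... | i , i<L , refl = suc i , s≤s i<L , refl

  length-placed : ∀ blk xs → length (placed blk xs) ≡ length xs
  length-placed blk []       = refl
  length-placed blk (x ∷ xs) = cong suc (length-placed (blk ∘ suc) xs)

  InDifferentBlocks : ℕ → ℕ → Set
  InDifferentBlocks y z = y / T ≢ z / T

  placed-separated : ∀ blk xs → (∀ {i j} → blk i ≡ blk j → i ≡ j) → All (_< T) xs →
                     AllPairs InDifferentBlocks (placed blk xs)
  placed-separated blk []       _   _              = []
  placed-separated blk (x ∷ xs) inj (x<T ∷ xs<T) =
    All.tabulate head-separated ∷ placed-separated (blk ∘ suc) xs (suc-injective ∘ inj) xs<T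
    where
    head-separated : ∀ {z} → z ∈ placed (blk ∘ suc) xs → InDifferentBlocks (vertex (blk 0) x) z
    head-separated z∈ same with ∈-placed⁻ (blk ∘ suc) xs z∈
    ... | i , x′ , _ , x′∈ , refl =
      0≢1+n (inj (trans (sym (vertex/T≡block (blk 0) x<T)) (trans same (vertex/T≡block (blk (suc i)) (All.lookup xs<T x′∈)))))

  module _ {e : EdgeCode} (wf : WellFormed e) where
    open WellFormed wf

    feet<T : All (_< T) (feet e)
    feet<T = All.map (λ x< → <-≤-trans x< (*-monoˡ-≤ q level<m)) feet-low

    vertices-separated : AllPairs InDifferentBlocks (vertices e)
    vertices-separated = All.tabulate apex-separated ∷ placed-separated (childBlock e) (feet e) (childBlock-injective e) feet<T
      where
      apex-separated : ∀ {z} → z ∈ placed (childBlock e) (feet e) → InDifferentBlocks (vertex (apexBlock e) (apex e)) z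
      apex-separated z∈ same with ∈-placed⁻ (childBlock e) (feet e) z∈
      ... | i , x , _ , x∈ , refl = <-irrefl
        (trans (sym (vertex/T≡block (apexBlock e) apex<T)) (trans same (vertex/T≡block (childBlock e i) (All.lookup feet<T x∈))))
        (apexBlock<childBlock wf i)

    length-vertices : length (vertices e) ≡ suc p
    length-vertices = cong suc (trans (length-placed (childBlock e) (feet e)) feet-length)

  apexCount : ℕ → ℕ
  apexCount j = (T ∸ j * q) * (suc j * q) ^ p

  length-apexCodes : ∀ j β → length (apexCodes j β) ≡ apexCount j
  length-apexCodes j β = trans
    (length-concatMap (λ w → map (edgeCode j β w) (tuples p (suc j * q)))
      (λ w → trans (length-map (edgeCode j β w) (tuples p (suc j * q))) (length-tuples p (suc j * q))) (range (j * q) T))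
    (cong (_* (suc j * q) ^ p) (length-range (j * q) T))

  apexCount-bound : ∀ j → r ^ r * apexCount j ≤ p ^ p * T ^ r + r ^ r * (T ^ p * q)
  apexCount-bound j with j <? m
  ... | yes j<m = apex-count-bound c m j q j<m
  ... | no  j≮m = subst (_≤ p ^ p * T ^ r + r ^ r * (T ^ p * q)) (sym (trans (cong (λ z → r ^ r * (z * (suc j * q) ^ p)) T∸jq≡0) (*-zeroʳ (r ^ r)))) z≤n
    where
    T∸jq≡0 : T ∸ j * q ≡ 0
    T∸jq≡0 = m≤n⇒m∸n≡0 (*-monoˡ-≤ q (≮⇒≥ j≮m))

  parentCodes : ℕ → ℕ → List EdgeCode
  parentCodes zero    β = []
  parentCodes (suc j) β with j <? m
  ... | yes _ = map (edgeCode j (β / D) (β % D / p)) (tuples p (suc j * q))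
  ... | no  _ = []

  length-parentCodes : ∀ j β → length (parentCodes j β) ≤ T ^ p
  length-parentCodes zero    β = z≤n
  length-parentCodes (suc j) β with j <? m
  ... | no  _   = z≤n
  ... | yes j<m = begin
    length (map (edgeCode j (β / D) (β % D / p)) (tuples p (suc j * q)))
      ≡⟨ trans (length-map (edgeCode j (β / D) (β % D / p)) (tuples p (suc j * q))) (length-tuples p (suc j * q)) ⟩
    (suc j * q) ^ p
      ≤⟨ ^-monoˡ-≤ p (*-monoˡ-≤ q j<m) ⟩
    T ^ p ∎
    where open ≤-Reasoning

  codesAt : ℕ → List EdgeCode
  codesAt B = apexCodes (B / W) (B % W) ++ parentCodes (B / W) (B % W)

  length-codesAt : ∀ B → length (codesAt B) ≤ apexCount (B / W) + T ^ p
  length-codesAt B = ≤-trans (≤-reflexive (length-++ (apexCodes (B / W) (B % W))))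
    (+-mono-≤ (≤-reflexive (length-apexCodes (B / W) (B % W))) (length-parentCodes (B / W) (B % W)))

  module _ {e : EdgeCode} (wf : WellFormed e) where
    open WellFormed wf

    apex∈codesAt : e ∈ codesAt (apexBlock e)
    apex∈codesAt = ∈-++⁺ˡ (subst₂ (λ j β → e ∈ apexCodes j β)
      (sym ([k*d+x]/d≡k (level e) (index e) W (index<W wf))) (sym ([k*d+x]%d≡x (level e) (index e) W (index<W wf)))
      (∈-apexCodes⁺ e wf))

    ∈-parentCodes : ∀ {k} → k < p → e ∈ parentCodes (suc (level e)) (childIndex e k)
    ∈-parentCodes {k} k<p with level e <? m
    ... | no  j≮m = ⊥-elim (j≮m level<m)
    ... | yes _   = subst (_∈ map (edgeCode (level e) (childIndex e k / D) (childIndex e k % D / p)) (tuples p (suc (level e) * q))) (cong₂ (λ β w → edgeCode (level e) β w (feet e)) parent-index parent-apex)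
      (∈-map⁺ (edgeCode (level e) (childIndex e k / D) (childIndex e k % D / p)) (∈-tuples⁺ p _ (feet e) feet-length feet-low))
      where
      rest<D : apex e * p + k < D
      rest<D = begin-strict
        apex e * p + k      <⟨ +-monoʳ-< (apex e * p) k<p ⟩
        apex e * p + p      ≡⟨ +-comm (apex e * p) p ⟩
        suc (apex e) * p    ≤⟨ *-monoˡ-≤ p apex<T ⟩
        D                   ∎
        where open ≤-Reasoning
      childIndex≡ : childIndex e k ≡ index e * D + (apex e * p + k)
      childIndex≡ = cong (_+ (apex e * p + k)) (*-comm D (index e))
      parent-index : childIndex e k / D ≡ index e
      parent-index = trans (cong (_/ D) childIndex≡) ([k*d+x]/d≡k (index e) _ D rest<D)
      parent-apex : childIndex e k % D / p ≡ apex e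
      parent-apex = trans (cong (λ z → z % D / p) childIndex≡)
        (trans (cong (_/ p) ([k*d+x]%d≡x (index e) _ D rest<D)) ([k*d+x]/d≡k (apex e) k p k<p))

    child∈codesAt : ∀ {k} → k < p → e ∈ codesAt (childBlock e k)
    child∈codesAt {k} k<p = ∈-++⁺ʳ (apexCodes (childBlock e k / W) (childBlock e k % W)) (subst₂ (λ j β → e ∈ parentCodes j β)
      (sym ([k*d+x]/d≡k (suc (level e)) _ W (childIndex<W wf k<p))) (sym ([k*d+x]%d≡x (suc (level e)) _ W (childIndex<W wf k<p)))
      (∈-parentCodes k<p))

  module Graph (n : ℕ) (fits : suc m * W ≤ n) where

    N : ℕ
    N = n * T

    vertex<N : ∀ {B x} → B < n → x < T → vertex B x < N
    vertex<N {B} {x} B<n x<T = begin-strict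
      B * T + x    <⟨ +-monoʳ-< (B * T) x<T ⟩
      B * T + T    ≡⟨ +-comm (B * T) T ⟩
      suc B * T    ≤⟨ *-monoˡ-≤ T B<n ⟩
      n * T        ∎
      where open ≤-Reasoning

    P : Partition N n
    P v = fromℕ< (m<n*o⇒m/o<n {toℕ v} {n} {T} (toℕ<n v))

    toℕ-P : ∀ v → toℕ (P v) ≡ toℕ v / T
    toℕ-P v = toℕ-fromℕ< _

    P≡⇒/T≡ : ∀ {x y} → P x ≡ P y → toℕ x / T ≡ toℕ y / T
    P≡⇒/T≡ {x} {y} Px≡Py = trans (sym (toℕ-P x)) (trans (cong toℕ Px≡Py) (toℕ-P y))

    toEdge : EdgeCode → Subset N
    toEdge e = fromList (vertices e)

    module _ {e : EdgeCode} (wf : WellFormed e) where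
      open WellFormed wf

      vertices<N : All (_< N) (vertices e)
      vertices<N = vertex<N (<-≤-trans (apexBlock<[1+m]*W wf) fits) apex<T ∷ All.tabulate foot<N
        where
        foot<N : ∀ {z} → z ∈ placed (childBlock e) (feet e) → z < N
        foot<N z∈ with ∈-placed⁻ (childBlock e) (feet e) z∈
        ... | i , x , i< , x∈ , refl = vertex<N
          (<-≤-trans (childBlock<[1+m]*W wf (subst (i <_) feet-length i<)) fits) (All.lookup (feet<T wf) x∈)

      ∣toEdge∣ : ∣ toEdge e ∣ ≡ suc p
      ∣toEdge∣ = trans
        (∣fromList∣ (AllPairs.map (λ different same → different (cong (_/ T) same)) (vertices-separated wf)) vertices<N)
        (length-vertices wf)

    _≟ₛ_ : (E F : Subset N) → Relation.Nullary.Dec (E ≡ F)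
    _≟ₛ_ = ≡-dec _≟ᵇ_

    edgeList : List (Subset N)
    edgeList = deduplicate _≟ₛ_ (map toEdge edgeCodes)

    ∈-edgeList⁻ : ∀ {E} → E ∈ edgeList → ∃ λ e → WellFormed e × E ≡ toEdge e
    ∈-edgeList⁻ E∈ with ∈-map⁻ toEdge (∈-deduplicate⁻ _≟ₛ_ (map toEdge edgeCodes) E∈)
    ... | e , e∈ , refl = e , ∈-edgeCodes⁻ e∈ , refl

    ∈-edgeList⁺ : ∀ {e} → WellFormed e → toEdge e ∈ edgeList
    ∈-edgeList⁺ wf = ∈-deduplicate⁺ _≟ₛ_ (∈-map⁺ toEdge (∈-edgeCodes⁺ _ wf))

    G : UniformHypergraph (suc p) N
    G = record
      { edges   = edgeList
      ; unique  = deduplicate-! _≟ₛ_ (map toEdge edgeCodes)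
      ; uniform = All.tabulate edgeList-uniform
      }
      where
      edgeList-uniform : ∀ {E} → E ∈ edgeList → ∣ E ∣ ≡ suc p
      edgeList-uniform E∈ with ∈-edgeList⁻ E∈
      ... | e , wf , refl = ∣toEdge∣ wf

    stretched : AllStretched G P
    stretched E E∈ x y x∈ y∈ Px≡Py with ∈-edgeList⁻ E∈
    ... | e , wf , refl with AllPairs-∈ (vertices-separated wf) (∈-fromList⁻ x∈) (∈-fromList⁻ y∈)
    ... | inj₁ x≡y           = toℕ-injective x≡y
    ... | inj₂ (inj₁ apart) = ⊥-elim (apart (P≡⇒/T≡ {x} {y} Px≡Py))
    ... | inj₂ (inj₂ apart) = ⊥-elim (apart (P≡⇒/T≡ {y} {x} (sym Px≡Py)))

    thick : Thick T P
    thick i = begin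
      T                                                   ≡⟨ sym (trans (length-map (vertex (toℕ i)) (upTo T)) (length-upTo T)) ⟩
      length (map (vertex (toℕ i)) (upTo T))              ≤⟨ Unique-⊆⇒length≤ block-unique block-⊆ ⟩
      length (map toℕ (filter (λ x → P x Fin.≟ i) (allFin N))) ≡⟨ length-map toℕ (filter (λ x → P x Fin.≟ i) (allFin N)) ⟩
      blockSize P i                                       ∎
      where
      open ≤-Reasoning
      block-unique : Unique (map (vertex (toℕ i)) (upTo T))
      block-unique = Unique.map⁺ (+-cancelˡ-≡ (toℕ i * T) _ _) (Unique.upTo⁺ T)
      block-⊆ : ∀ {z} → z ∈ map (vertex (toℕ i)) (upTo T) → z ∈ map toℕ (filter (λ x → P x Fin.≟ i) (allFin N))
      block-⊆ z∈ with ∈-map⁻ (vertex (toℕ i)) z∈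
      ... | x , x∈ , refl = subst (_∈ map toℕ _) (toℕ-fromℕ< z<N)
        (∈-map⁺ toℕ (∈-filter⁺ (λ x → P x Fin.≟ i) (∈-allFin z) (toℕ-injective (begin-equality
          toℕ (P z)                            ≡⟨ toℕ-P z ⟩
          toℕ z / T                            ≡⟨ cong (_/ T) (toℕ-fromℕ< z<N) ⟩
          vertex (toℕ i) x / T                 ≡⟨ vertex/T≡block (toℕ i) (∈-upTo⁻ x∈) ⟩
          toℕ i                                ∎))))
        where
        z<N = vertex<N (toℕ<n i) (∈-upTo⁻ x∈)
        z = fromℕ< z<N

    module Transversal (I : IndependentTransversal G P) where
      open IndependentTransversal I

      position : ℕ → ℕ
      position B with B <? n
      ... | yes B<n = toℕ (choice (fromℕ< B<n)) % T
      ... | no  _   = 0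

      position<T : ∀ B → position B < T
      position<T B with B <? n
      ... | yes B<n = m%n<n (toℕ (choice (fromℕ< B<n))) T
      ... | no  _   = s≤s z≤n

      chosen : ∀ {B} (B<n : B < n) → toℕ (choice (fromℕ< B<n)) ≡ vertex B (position B)
      chosen {B} B<n with B <? n
      ... | no B≮n = ⊥-elim (B≮n B<n)
      ... | yes _  = begin-equality
        toℕ v                   ≡⟨ m≡m%n+[m/n]*n (toℕ v) T ⟩
        toℕ v % T + toℕ v / T * T ≡⟨ cong (λ k → toℕ v % T + k * T) (trans (sym (toℕ-P v)) (trans (cong toℕ (inBlock _)) (toℕ-fromℕ< B<n))) ⟩
        toℕ v % T + B * T       ≡⟨ +-comm (toℕ v % T) (B * T) ⟩
        vertex B (toℕ v % T)    ∎
        where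
        open ≤-Reasoning
        v = choice (fromℕ< B<n)

      chosen-vertex : ∀ {B x} → B < n → toℕ x ≡ vertex B (position B) → ∃ λ i → x ≡ choice i
      chosen-vertex B<n x≡ = fromℕ< B<n , toℕ-injective (trans x≡ (sym (chosen B<n)))

      -- A high position w ≥ j * q would, together with the positions in the
      -- children of w (low by induction), put an edge inside the transversal.
      low-positions : ∀ d j β → d + j ≡ m → β < D ^ j → position (levelBlock j β) < j * q
      low-positions zero    j β refl β< = position<T (levelBlock m β)
      low-positions (suc d) j β d+j≡m β< with position (levelBlock j β) <? j * q
      ... | yes low = low
      ... | no ¬low = ⊥-elim (independent (toEdge e) (∈-edgeList⁺ wf) all-chosen)
        where
        w = position (levelBlock j β)
        feetOf : ℕ → ℕ
        feetOf k = position (levelBlock (suc j) (D * β + (w * p + k)))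
        e = edgeCode j β w (applyUpTo feetOf p)
        j<m : j < m
        j<m = subst (j <_) d+j≡m (s≤s (m≤n+m j d))
        wf : WellFormed e
        wf = record
          { level<m = j<m ; index<D^ = β< ; apex-high = ≮⇒≥ ¬low ; apex<T = position<T _
          ; feet-length = length-applyUpTo feetOf p
          ; feet-low = applyUpTo⁺₁ feetOf p λ k<p →
              low-positions d (suc j) (childIndex e _) (trans (+-suc d j) d+j≡m) (childIndex<D^[1+level] e β< (position<T _) k<p) }
        all-chosen : ∀ x → x ∈ₛ toEdge e → ∃ λ i → x ≡ choice i
        all-chosen x x∈ with ∈-fromList⁻ x∈
        ... | here x≡apex = chosen-vertex (<-≤-trans (apexBlock<[1+m]*W wf) fits) x≡apex
        ... | there x∈feet with ∈-placed-applyUpTo⁻ (childBlock e) feetOf p x∈feet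
        ...   | k , k<p , x≡foot = chosen-vertex (<-≤-trans (childBlock<[1+m]*W wf k<p) fits) x≡foot

    noIndependentTransversal : ¬ IndependentTransversal G P
    noIndependentTransversal I = n≮0 (Transversal.low-positions I m 0 0 (+-identityʳ m) (s≤s z≤n))

    edgesMeeting≤ : ∀ i → edgesMeeting G P i ≤ apexCount (toℕ i / W) + T ^ p
    edgesMeeting≤ i = begin
      edgesMeeting G P i                         ≤⟨ Unique-⊆⇒length≤ (Unique.filter⁺ meets (deduplicate-! _≟ₛ_ (map toEdge edgeCodes))) meeting-⊆ ⟩
      length (map toEdge (codesAt (toℕ i)))      ≡⟨ length-map toEdge (codesAt (toℕ i)) ⟩
      length (codesAt (toℕ i))                   ≤⟨ length-codesAt (toℕ i) ⟩
      apexCount (toℕ i / W) + T ^ p              ∎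
      where
      open ≤-Reasoning
      meets = λ E → any? (λ x → (x ∈? E) ×-dec (P x Fin.≟ i))
      in-block : ∀ {x B y} → toℕ x ≡ vertex B y → y < T → P x ≡ i → B ≡ toℕ i
      in-block {x} {B} x≡ y<T Px≡i = trans (sym (vertex/T≡block B y<T)) (trans (cong (_/ T) (sym x≡)) (trans (sym (toℕ-P x)) (cong toℕ Px≡i)))
      meeting-⊆ : ∀ {E} → E ∈ filter meets edgeList → E ∈ map toEdge (codesAt (toℕ i))
      meeting-⊆ E∈ with ∈-filter⁻ meets E∈
      ... | E∈edges , x , x∈ , Px≡i with ∈-edgeList⁻ E∈edges
      ... | e , wf , refl with ∈-fromList⁻ x∈
      ... | here x≡apex = ∈-map⁺ toEdge (subst (λ B → e ∈ codesAt B) (in-block x≡apex (WellFormed.apex<T wf) Px≡i) (apex∈codesAt wf))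
      ... | there x∈feet with ∈-placed⁻ (childBlock e) (feet e) x∈feet
      ...   | k , y , k< , y∈ , x≡foot = ∈-map⁺ toEdge (subst (λ B → e ∈ codesAt B) (in-block x≡foot (All.lookup (feet<T wf) y∈) Px≡i)
                (child∈codesAt wf (subst (k <_) (WellFormed.feet-length wf) k<)))

module Counterexample where

  open Arithmetic using ([m*n]^k≡m^k*n^k; edge-count-bound)
  open import Data.Nat using (ℕ; suc; _+_; _*_; _^_; _≤_; _<_; s≤s; z≤n; NonZero; _/_; _%_)
  open import Data.Nat.Properties
  open import Data.Nat.DivMod using (m/n*n≤m; m%n≤n; m≡m%n+[m/n]*n)
  open import Data.Nat.Tactic.RingSolver using (solve-∀)
  open import Data.Fin using (toℕ)
  open import Data.Product using (Σ; ∃; _×_; _,_; proj₁; proj₂)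
  open import Relation.Nullary using (¬_)
  open import Relation.Binary.PropositionalEquality

  open ≤-Reasoning

  ⌈t/m⌉-multiple : ∀ t m .{{_ : NonZero m}} → t ≤ m * suc (t / m) × m * suc (t / m) ≤ t + m
  ⌈t/m⌉-multiple t m = lower , upper
    where
    m*[1+t/m]≡m+t/m*m : m * suc (t / m) ≡ m + t / m * m
    m*[1+t/m]≡m+t/m*m = trans (*-suc m (t / m)) (cong (m +_) (*-comm m (t / m)))
    lower = begin
      t                    ≡⟨ m≡m%n+[m/n]*n t m ⟩
      t % m + t / m * m    ≤⟨ +-monoˡ-≤ (t / m * m) (m%n≤n t m) ⟩
      m + t / m * m        ≡⟨ m*[1+t/m]≡m+t/m*m ⟨
      m * suc (t / m)      ∎
    upper = begin
      m * suc (t / m)      ≡⟨ m*[1+t/m]≡m+t/m*m ⟩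
      m + t / m * m        ≤⟨ +-monoʳ-≤ m (m/n*n≤m t m) ⟩
      m + t                ≡⟨ +-comm m t ⟩
      t + m                ∎

  -- The edge bound says edgesMeeting G P i ≤ (p ^ p / r ^ r + 1 / (den + 1)) * t ^ r.
  BadInstance : ℕ → ℕ → ℕ → ℕ → Set
  BadInstance c den t n = let p = suc c; r = suc p in
    ∃ λ N → Σ (UniformHypergraph r N) λ G → Σ (Partition N n) λ P →
      Thick t P × AllStretched G P
      × (∀ i → r ^ r * suc den * edgesMeeting G P i ≤ (p ^ p * suc den + r ^ r) * t ^ r)
      × ¬ IndependentTransversal G P

  counterexample : ∀ c den → ∃ λ C → ∃ λ t₀ → ∀ t → t₀ ≤ t → ∀ n → t ^ C < n → BadInstance c den t n
  counterexample c den = C , t₀ , construct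
    where
    p = suc c
    r = suc p
    a = 6 * 2 ^ p * suc den
    m = suc a
    C = suc (m + m)
    t-large = 2 * suc den * p ^ p * r * m * 2 ^ p
    t₀ = t-large + (m + (p + p))
    construct : ∀ t → t₀ ≤ t → ∀ n → t ^ C < n → BadInstance c den t n
    construct t t₀≤t n tᶜ<n = N , G , P , (λ i → ≤-trans t≤T (thick i)) , stretched , bound , noIndependentTransversal
      where
      open Construction c a (t / m) hiding (p; r; m)
      t≤T = proj₁ (⌈t/m⌉-multiple t m)
      T≤t+m = proj₂ (⌈t/m⌉-multiple t m)
      below-t : ∀ {k} → k ≤ t₀ → k ≤ t
      below-t k≤t₀ = ≤-trans k≤t₀ t₀≤t
      m≤t : m ≤ t
      m≤t = below-t (≤-trans (m≤m+n m (p + p)) (m≤n+m _ t-large))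
      1+m≤t : suc m ≤ t
      1+m≤t = below-t (≤-trans (subst (_≤ m + (p + p)) (+-comm m 1) (+-monoʳ-≤ m (s≤s z≤n))) (m≤n+m _ t-large))
      2p≤t : p + p ≤ t
      2p≤t = below-t (≤-trans (m≤n+m (p + p) m) (m≤n+m _ t-large))
      D≤t*t : D ≤ t * t
      D≤t*t = begin
        T * p             ≤⟨ *-monoˡ-≤ p (≤-trans T≤t+m (+-monoʳ-≤ t m≤t)) ⟩
        (t + t) * p       ≡⟨ double t p ⟩
        t * (p + p)       ≤⟨ *-monoʳ-≤ t 2p≤t ⟩
        t * t             ∎
        where
        double : ∀ t p → (t + t) * p ≡ t * (p + p)
        double = solve-∀
      fits : suc m * W ≤ n
      fits = begin
        suc m * D ^ m         ≤⟨ *-mono-≤ 1+m≤t (^-monoˡ-≤ m D≤t*t) ⟩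
        t * (t * t) ^ m       ≡⟨ cong (t *_) (trans ([m*n]^k≡m^k*n^k m t t) (sym (^-distribˡ-+-* t m m))) ⟩
        t ^ C                 ≤⟨ <⇒≤ tᶜ<n ⟩
        n                     ∎
      open Graph n fits
      bound : ∀ i → r ^ r * suc den * edgesMeeting G P i ≤ (p ^ p * suc den + r ^ r) * t ^ r
      bound i = edge-count-bound c (suc den) m t q (apexCount (toℕ i / W)) (edgesMeeting G P i)
        T≤t+m m≤t (n≤1+n a) (below-t (m≤m+n t-large _)) (apexCount-bound (toℕ i / W)) (edgesMeeting≤ i)

open import Data.Nat using (ℕ; _≤_; _<_; _^_; suc; s≤s; z≤n)
open import Data.Fin using (Fin)
open import Data.Product using (Σ; ∃; _×_; _,_)
open import Data.Integer using (+_)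
open import Data.Rational as ℚ using (ℚ; 0ℚ; _+_; _*_; _/_)
open import Relation.Nullary using (¬_)

theorem4p2 : (r : ℕ) → 2 ≤ r → (ε : ℚ) → 0ℚ ℚ.< ε →
    ∃ λ (C : ℕ) → ∃ λ (t₀ : ℕ) → (t : ℕ) → t₀ ≤ t → (n : ℕ) → t ^ C < n →
    ∃ λ (N : ℕ) → Σ (UniformHypergraph r N) λ G → Σ (Partition N n) λ P →
      Thick t P × AllStretched G P
      × ((i : Fin n) → (+ edgesMeeting G P i / 1) ℚ.≤ (threshold r + ε) * (+ (t ^ r) / 1))
      × ¬ IndependentTransversal G P
theorem4p2 (suc (suc c)) (s≤s (s≤s z≤n)) ε 0<ε =
  let den , ≤-threshold+ε = RationalBounds.≤-threshold+ε c ε 0<ε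
      C , t₀ , construct = Counterexample.counterexample c den
  in C , t₀ , λ t t₀≤t n tᶜ<n →
  let N , G , P , thick , stretched , edge-bound , no-transversal = construct t t₀≤t n tᶜ<n
  in N , G , P , thick , stretched , (λ i → ≤-threshold+ε (edgesMeeting G P i) (t ^ suc (suc c)) (edge-bound i)) , no-transversal
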